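{- Let $u=x_0^{\alpha_0}x_1^{\alpha_1}\cdots x_n^{\alpha_n}$ and $v=y_0^{\beta_0}y_1^{\beta_1}\cdots y_m^{\beta_m}$ be nonempty words over $\{a,b\}$ written in run form. Then $\delta(u)+\delta(v)-1\le\delta(uv)\le\delta(u)+\delta(v)$. Moreover, $\delta(uv)=\delta(u)+\delta(v)$ if and only if the last letter of $u$ differs from the first letter of $v$ and $|u_2|$ and $|v_1|$ are both even.
   Context: Run form: a nonempty word is uniquely written $x_0^{\alpha_0}\cdots x_n^{\alpha_n}$ with letters $x_i$, $\alpha_i\ge1$, $x_{i+1}\ne x_i$. The function $\delta$: $\delta(\varepsilon)=1$; for $v=x_0^{\alpha_0}\cdots x_n^{\alpha_n}$ define $\delta_i(v)\in\{0,1\}$: $\delta_0(v)=\delta_n(v)=1$; for $0<i<n$, $\delta_i(v)=1$ if $\alpha_i>1$; if $\alpha_i=1$ and $\alpha_{i-1}>1$ then $\delta_i(v)=0$; if $\alpha_i=\alpha_{i-1}=1$ then $\delta_i(v)=1$ iff $\delta_{i-1}(v)=0$; and $\delta(v)=\sum_{i=0}^n\delta_i(v)$. For $v=y_0^{\beta_0}\cdots y_m^{\beta_m}$: $v_1=\varepsilon$ if $\beta_0>1$ or $m=0$; otherwise $v_1=y_0y_1\cdots y_i$ where $i<m$ is the largest index with $\beta_0=\beta_1=\cdots=\beta_i=1$. For $u=x_0^{\alpha_0}\cdots x_n^{\alpha_n}$: $u_2=\varepsilon$ if $\alpha_n>1$ or $n=0$; otherwise $u_2=x_jx_{j+1}\cdots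 x_n$ where $j>0$ is the smallest index with $\alpha_j=\cdots=\alpha_n=1$. -}

module Defs where

open import Data.Nat using (ℕ; zero; suc; _+_)
open import Data.List using (List; []; _∷_; reverse; length; replicate; concatMap)
open import Data.Product using (_×_; _,_; proj₁)
open import Data.Bool using (Bool; true; false)

data Letter : Set where
  a b : Letter

Word : Set
Word = List Letter

eqL : Letter → Letter → Bool
eqL a a = true
eqL b b = true
eqL _ _ = false

-- A run x^(suc k) is represented as (x , k), i.e. the exponent is suc k ≥ 1.
Run : Set
Run = Letter × ℕ

runsAux : Letter → ℕ → Word → List Run
runsAux x k [] = (x , k) ∷ []
runsAux x k (y ∷ w) with eqL x y
... | true  = runsAux x (suc k) w
... | false = (x , k) ∷ runsAux y 0 w

runs : Word → List Run
runs [] = []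
runs (x ∷ w) = runsAux x 0 w

-- δ computed on the list of exponents (each stored as exponent - 1).
-- δrest pk pd ks : sum of δ_i over the indices i whose (exponent-1) are listed
-- in ks, where the previous run has (exponent-1) = pk and δ-value pd, and
-- the last element of ks is the final index n (δ_n = 1).
δrest : ℕ → ℕ → List ℕ → ℕ
δrest pk pd [] = 0
δrest pk pd (k ∷ []) = 1                           -- δ_n = 1
δrest pk pd (suc k ∷ ks@(_ ∷ _)) = 1 + δrest (suc k) 1 ks   -- α_i > 1
δrest (suc pk) pd (zero ∷ ks@(_ ∷ _)) = δrest zero 0 ks   -- α_i = 1, α_{i-1} > 1
δrest zero zero (zero ∷ ks@(_ ∷ _)) = 1 + δrest zero 1 ks -- α_i = α_{i-1} = 1, δ_{i-1} = 0
δrest zero (suc _) (zero ∷ ks@(_ ∷ _)) = δrest zero 0 ks  -- α_i = α_{i-1} = 1, δ_{i-1} = 1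

δExps : List ℕ → ℕ
δExps [] = 1
δExps (k ∷ ks) = 1 + δrest k 1 ks             -- δ_0 = 1

exps : List Run → List ℕ
exps [] = []
exps ((_ , k) ∷ rs) = k ∷ exps rs

δ : Word → ℕ
δ w = δExps (exps (runs w))

-- v₁: letters y_0 … y_i of the maximal prefix of runs with exponent 1,
-- never including the last run (i < m).
leadOnes : List Run → Word
leadOnes [] = []
leadOnes ((y , k) ∷ []) = []
leadOnes ((y , zero) ∷ rs@(_ ∷ _)) = y ∷ leadOnes rs
leadOnes ((y , suc k) ∷ rs@(_ ∷ _)) = []

v₁ : Word → Word
v₁ v = leadOnes (runs v)

-- u₂: letters x_j … x_n of the maximal suffix of runs with exponent 1,
-- never including the first run (j > 0).  Computed on the reversed run list.
u₂ : Word → Word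
u₂ u = reverse (leadOnes (reverse (runs u)))

lastLetter : Letter → Word → Letter
lastLetter x [] = x
lastLetter x (y ∷ w) = lastLetter y w

-- Write each run exponent as αᵢ − 1.  Unfolding the paper's rule, δᵢ = 1 exactly when αᵢ > 1 or
-- δᵢ₋₁ = 0, so δ is one plus the number of ones produced by a Boolean recurrence run over all
-- but the last exponent.  If the last letter of u equals the first letter of v, the two boundary
-- runs fuse into a run of length > 1, which resets the recurrence, and exactly one unit is lost.
-- Otherwise the recurrence for uv runs through the last run of u, where it yields δ = 1 iff |u₂|
-- is even, and then through v: starting the recurrence of v from δ = 1 instead of δ = 0 only
-- flips the alternating pattern along the leading runs of length one, which loses a unit iff
-- |v₁| is odd.
module Submission where

open import Defs
open import Data.Bool using (Bool; true; false; not; _∧_; T)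
open import Data.Bool.Properties using (T-∧; T-not-≡; not-involutive)
open import Data.Empty using (⊥-elim)
open import Data.List using (List; []; _∷_; _++_; _∷ʳ_; reverse; length)
open import Data.List.Properties using (++-assoc; reverse-++; length-reverse)
open import Data.List.Reverse using (Reverse; []; _∶_∶ʳ_; reverseView)
open import Data.Nat using (ℕ; zero; suc; _+_; _∸_; _≤_)
open import Data.Nat.Divisibility using (_∣_; _∣0; ∣-refl; ∣1⇒≡1; ∣m∣n⇒∣m+n; ∣m+n∣m⇒∣n)
open import Data.Nat.Properties using (+-assoc; +-comm; +-identityʳ; +-suc; m∸n≤m; ≤-refl; n≤1+n; 1+n≢n)
open import Data.Nat.Tactic.RingSolver using (solve-∀)
open import Data.Product using (_×_; _,_; ∃₂)
open import Data.Product.Function.NonDependent.Propositional using (_×-⇔_)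
open import Function.Bundles using (_⇔_; mk⇔; Equivalence)
open import Function.Construct.Composition using (_⇔-∘_)
open import Function.Properties.Equivalence using () renaming (refl to ⇔-refl)
open import Relation.Binary.Definitions using (DecidableEquality)
open import Relation.Binary.PropositionalEquality
open import Relation.Nullary using (yes; no; contradiction)

bit : Bool → ℕ
bit true = 1
bit false = 0

-- δᵢ from δᵢ₋₁ and αᵢ − 1; the start value δ₋₁ = false makes δ₀ = 1.
nextδ : Bool → ℕ → Bool
nextδ _ (suc _) = true
nextδ d zero = not d

countδ : Bool → List ℕ → ℕ
countδ d [] = 0
countδ d (k ∷ ks) = bit (nextδ d k) + countδ (nextδ d k) ks

lastδ : Bool → List ℕ → Bool
lastδ d [] = d
lastδ d (k ∷ ks) = lastδ (nextδ d k) ks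

-- δrest ignores pd after a run of length > 1, where δᵢ₋₁ is 1 anyway.
prevδ : ℕ → ℕ → Bool
prevδ (suc _) _ = true
prevδ zero zero = false
prevδ zero (suc _) = true

δrest-∷ʳ : ∀ pk pd ks k → δrest pk pd (ks ∷ʳ k) ≡ countδ (prevδ pk pd) ks + 1
δrest-∷ʳ pk pd [] k = refl
δrest-∷ʳ pk pd (suc i ∷ []) k = refl
δrest-∷ʳ pk pd (suc i ∷ ks@(_ ∷ _)) k = cong suc (δrest-∷ʳ (suc i) 1 ks k)
δrest-∷ʳ (suc pk) pd (zero ∷ []) k = refl
δrest-∷ʳ (suc pk) pd (zero ∷ ks@(_ ∷ _)) k = δrest-∷ʳ zero 0 ks k
δrest-∷ʳ zero zero (zero ∷ []) k = refl
δrest-∷ʳ zero zero (zero ∷ ks@(_ ∷ _)) k = cong suc (δrest-∷ʳ zero 1 ks k)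
δrest-∷ʳ zero (suc pd) (zero ∷ []) k = refl
δrest-∷ʳ zero (suc pd) (zero ∷ ks@(_ ∷ _)) k = δrest-∷ʳ zero 0 ks k

δExps-∷ʳ : ∀ ks k → δExps (ks ∷ʳ k) ≡ countδ false ks + 1
δExps-∷ʳ [] k = refl
δExps-∷ʳ (zero ∷ ks) k = cong suc (δrest-∷ʳ zero 1 ks k)
δExps-∷ʳ (suc i ∷ ks) k = cong suc (δrest-∷ʳ (suc i) 1 ks k)

countδ-++ : ∀ d xs ys → countδ d (xs ++ ys) ≡ countδ d xs + countδ (lastδ d xs) ys
countδ-++ d [] ys = refl
countδ-++ d (k ∷ xs) ys =
  trans (cong (bit (nextδ d k) +_) (countδ-++ (nextδ d k) xs ys)) (sym (+-assoc (bit (nextδ d k)) _ _))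

lastδ-∷ʳ : ∀ d ks k → lastδ d (ks ∷ʳ k) ≡ nextδ (lastδ d ks) k
lastδ-∷ʳ d [] k = refl
lastδ-∷ʳ d (i ∷ ks) k = lastδ-∷ʳ (nextδ d i) ks k

even : ℕ → Bool
even zero = true
even (suc n) = not (even n)

T-even⇔2∣ : ∀ n → T (even n) ⇔ 2 ∣ n
T-even⇔2∣ zero = mk⇔ (λ _ → 2 ∣0) (λ _ → _)
T-even⇔2∣ (suc zero) = mk⇔ (λ ()) (λ 2∣1 → contradiction (∣1⇒≡1 2∣1) λ ())
T-even⇔2∣ (suc (suc n)) rewrite not-involutive (even n) =
  mk⇔ (λ e → ∣m∣n⇒∣m+n ∣-refl (to e)) (λ 2∣2+n → from (∣m+n∣m⇒∣n 2∣2+n ∣-refl))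
  where open Equivalence (T-even⇔2∣ n)

leadingZeros : List ℕ → ℕ
leadingZeros [] = 0
leadingZeros (zero ∷ ks) = suc (leadingZeros ks)
leadingZeros (suc _ ∷ _) = 0

-- Mirrors leadOnes: the last entry is never counted.
leadingZeros⁻ : List ℕ → ℕ
leadingZeros⁻ [] = 0
leadingZeros⁻ (k ∷ []) = 0
leadingZeros⁻ (zero ∷ ks@(_ ∷ _)) = suc (leadingZeros⁻ ks)
leadingZeros⁻ (suc _ ∷ _ ∷ _) = 0

leadingZeros⁻-∷ʳ : ∀ ks k → leadingZeros⁻ (ks ∷ʳ k) ≡ leadingZeros ks
leadingZeros⁻-∷ʳ [] k = refl
leadingZeros⁻-∷ʳ (zero ∷ []) k = refl
leadingZeros⁻-∷ʳ (zero ∷ ks@(_ ∷ _)) k = cong suc (leadingZeros⁻-∷ʳ ks k)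
leadingZeros⁻-∷ʳ (suc _ ∷ []) k = refl
leadingZeros⁻-∷ʳ (suc _ ∷ _ ∷ _) k = refl

bit-flip : ∀ {m n} b → m ≡ n + bit b → suc n ≡ m + bit (not b)
bit-flip {m} {n} true  m≡n+1 = sym (trans (+-identityʳ m) (trans m≡n+1 (+-comm n 1)))
bit-flip {n = n} false refl = trans (cong suc (sym (+-identityʳ n))) (+-comm 1 (n + 0))

countδ-false-true : ∀ ks → countδ false ks ≡ countδ true ks + bit (not (even (leadingZeros ks)))
countδ-false-true [] = refl
countδ-false-true (zero ∷ ks) = bit-flip (not (even (leadingZeros ks))) (countδ-false-true ks)
countδ-false-true (suc _ ∷ ks) = sym (+-identityʳ _)

nextδ-lastδ : ∀ {M} → Reverse M → ∀ j → nextδ (lastδ false M) j ≡ even (leadingZeros⁻ (reverse (M ∷ʳ j)))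
nextδ-lastδ [] zero = refl
nextδ-lastδ [] (suc j) = refl
nextδ-lastδ (M ∶ rM ∶ʳ m) zero
  rewrite lastδ-∷ʳ false M m | nextδ-lastδ rM m | reverse-++ (M ∷ʳ m) (zero ∷ []) | reverse-++ M (m ∷ []) = refl
nextδ-lastδ (M ∶ _ ∶ʳ m) (suc j)
  rewrite reverse-++ (M ∷ʳ m) (suc j ∷ []) | reverse-++ M (m ∷ []) = refl

countδ-junction : ∀ t N → suc (countδ false N) ≡ bit t + countδ t N + bit (not (t ∧ even (leadingZeros N)))
countδ-junction true N = cong suc (countδ-false-true N)
countδ-junction false N = +-comm 1 (countδ false N)

δExps-join : ∀ M j N l →
  δExps (M ∷ʳ j) + δExps (N ∷ʳ l) ≡
  δExps (M ++ j ∷ (N ∷ʳ l)) + bit (not (even (leadingZeros⁻ (reverse (M ∷ʳ j))) ∧ even (leadingZeros⁻ (N ∷ʳ l))))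
δExps-join M j N l = begin
  δExps (M ∷ʳ j) + δExps (N ∷ʳ l)
    ≡⟨ cong₂ _+_ (δExps-∷ʳ M j) (δExps-∷ʳ N l) ⟩
  cM + 1 + (countδ false N + 1)
    ≡⟨ regroup cM (countδ false N) ⟩
  cM + suc (countδ false N) + 1
    ≡⟨ cong (λ n → cM + n + 1) (countδ-junction t N) ⟩
  cM + (bit t + countδ t N + bit (not d)) + 1
    ≡⟨ pull-out cM (bit t + countδ t N) (bit (not d)) ⟩
  cM + (bit t + countδ t N) + 1 + bit (not d)
    ≡⟨ cong (λ n → n + 1 + bit (not d)) (countδ-++ false M (j ∷ N)) ⟨
  countδ false (M ++ j ∷ N) + 1 + bit (not d)
    ≡⟨ cong (_+ bit (not d)) (δExps-∷ʳ (M ++ j ∷ N) l) ⟨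
  δExps ((M ++ j ∷ N) ∷ʳ l) + bit (not d)
    ≡⟨ cong₂ (λ L b → δExps L + bit (not b)) (++-assoc M (j ∷ N) (l ∷ [])) d≡ ⟩
  δExps (M ++ j ∷ (N ∷ʳ l)) + bit (not (even (leadingZeros⁻ (reverse (M ∷ʳ j))) ∧ even (leadingZeros⁻ (N ∷ʳ l))))
    ∎
  where
  open ≡-Reasoning
  cM = countδ false M
  t = nextδ (lastδ false M) j
  d = t ∧ even (leadingZeros N)
  d≡ : d ≡ even (leadingZeros⁻ (reverse (M ∷ʳ j))) ∧ even (leadingZeros⁻ (N ∷ʳ l))
  d≡ = cong₂ _∧_ (nextδ-lastδ (reverseView M) j) (cong even (sym (leadingZeros⁻-∷ʳ N l)))
  regroup : ∀ a b → a + 1 + (b + 1) ≡ a + suc b + 1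
  regroup = solve-∀
  pull-out : ∀ a b c → a + (b + c) + 1 ≡ a + b + 1 + c
  pull-out = solve-∀

-- The fused run has length > 1, so it resets the recurrence whatever m is.
δExps-merge : ∀ M j e m E → δExps (M ∷ʳ j) + δExps (e ∷ E) ≡ δExps (M ++ suc m ∷ E) + 1
δExps-merge M j e m E with reverseView E
... | [] = begin
  δExps (M ∷ʳ j) + 1          ≡⟨ cong (_+ 1) (δExps-∷ʳ M j) ⟩
  countδ false M + 1 + 1      ≡⟨ cong (_+ 1) (δExps-∷ʳ M (suc m)) ⟨
  δExps (M ∷ʳ suc m) + 1      ∎
  where open ≡-Reasoning
... | R ∶ _ ∶ʳ r = begin
  δExps (M ∷ʳ j) + δExps ((e ∷ R) ∷ʳ r)
    ≡⟨ cong₂ _+_ (δExps-∷ʳ M j) (δExps-∷ʳ (e ∷ R) r) ⟩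
  cM + 1 + (countδ false (e ∷ R) + 1)
    ≡⟨ cong (λ n → cM + 1 + (n + 1)) (countδ-false-∷ e) ⟩
  cM + 1 + (suc cR + 1)
    ≡⟨ regroup cM (suc cR) ⟩
  cM + suc cR + 1 + 1
    ≡⟨ cong (λ n → n + 1 + 1) (countδ-++ false M (suc m ∷ R)) ⟨
  countδ false (M ++ suc m ∷ R) + 1 + 1
    ≡⟨ cong (_+ 1) (δExps-∷ʳ (M ++ suc m ∷ R) r) ⟨
  δExps ((M ++ suc m ∷ R) ∷ʳ r) + 1
    ≡⟨ cong (λ L → δExps L + 1) (++-assoc M (suc m ∷ R) (r ∷ [])) ⟩
  δExps (M ++ suc m ∷ R ∷ʳ r) + 1
    ∎
  where
  open ≡-Reasoning
  cM = countδ false M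
  cR = countδ true R
  regroup : ∀ a b → a + 1 + (b + 1) ≡ a + b + 1 + 1
  regroup = solve-∀
  countδ-false-∷ : ∀ k → countδ false (k ∷ R) ≡ suc cR
  countδ-false-∷ zero = refl
  countδ-false-∷ (suc _) = refl

exps-++ : ∀ P Q → exps (P ++ Q) ≡ exps P ++ exps Q
exps-++ [] Q = refl
exps-++ ((_ , k) ∷ P) Q = cong (k ∷_) (exps-++ P Q)

exps-reverse : ∀ P → exps (reverse P) ≡ reverse (exps P)
exps-reverse [] = refl
exps-reverse ((y , k) ∷ P) = begin
  exps (reverse ((y , k) ∷ P))       ≡⟨ cong exps (reverse-++ ((y , k) ∷ []) P) ⟩
  exps (reverse P ∷ʳ (y , k))        ≡⟨ exps-++ (reverse P) ((y , k) ∷ []) ⟩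
  exps (reverse P) ∷ʳ k              ≡⟨ cong (_∷ʳ k) (exps-reverse P) ⟩
  reverse (exps P) ∷ʳ k              ≡⟨ reverse-++ (k ∷ []) (exps P) ⟨
  reverse (k ∷ exps P)               ∎
  where open ≡-Reasoning

length-leadOnes : ∀ R → length (leadOnes R) ≡ leadingZeros⁻ (exps R)
length-leadOnes [] = refl
length-leadOnes ((y , k) ∷ []) = refl
length-leadOnes ((y , zero) ∷ R@(_ ∷ _)) = cong suc (length-leadOnes R)
length-leadOnes ((y , suc k) ∷ _ ∷ _) = refl

δRuns-join : ∀ P z j P′ z′ l →
  let U = P ∷ʳ (z , j)
      V = P′ ∷ʳ (z′ , l)
  in δExps (exps U) + δExps (exps V) ≡
     δExps (exps (P ++ (z , j) ∷ V)) + bit (not (even (length (reverse (leadOnes (reverse U)))) ∧ even (length (leadOnes V))))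
δRuns-join P z j P′ z′ l
  rewrite exps-++ P ((z , j) ∷ P′ ∷ʳ (z′ , l))
        | length-reverse (leadOnes (reverse (P ∷ʳ (z , j))))
        | length-leadOnes (reverse (P ∷ʳ (z , j)))
        | length-leadOnes (P′ ∷ʳ (z′ , l))
        | exps-reverse (P ∷ʳ (z , j))
        | exps-++ P ((z , j) ∷ [])
        | exps-++ P′ ((z′ , l) ∷ [])
  = δExps-join (exps P) j (exps P′) l

δRuns-merge : ∀ P z j e m Q →
  δExps (exps (P ∷ʳ (z , j))) + δExps (exps ((z , e) ∷ Q)) ≡ δExps (exps (P ++ (z , suc m) ∷ Q)) + 1
δRuns-merge P z j e m Q
  rewrite exps-++ P ((z , j) ∷ []) | exps-++ P ((z , suc m) ∷ Q)
  = δExps-merge (exps P) j e m (exps Q)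

runsAux-++ : ∀ x k w → ∃₂ λ P j →
  runsAux x k w ≡ P ∷ʳ (lastLetter x w , j) ×
  (∀ vs → runsAux x k (w ++ vs) ≡ P ++ runsAux (lastLetter x w) j vs)
runsAux-++ x k [] = [] , k , refl , λ _ → refl
runsAux-++ a k (a ∷ w) = runsAux-++ a (suc k) w
runsAux-++ b k (b ∷ w) = runsAux-++ b (suc k) w
runsAux-++ a k (b ∷ w) with P , j , split , split-++ ← runsAux-++ b 0 w =
  (a , k) ∷ P , j , cong ((a , k) ∷_) split , λ vs → cong ((a , k) ∷_) (split-++ vs)
runsAux-++ b k (a ∷ w) with P , j , split , split-++ ← runsAux-++ a 0 w =
  (b , k) ∷ P , j , cong ((b , k) ∷_) split , λ vs → cong ((b , k) ∷_) (split-++ vs)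

runsAux-head : ∀ y w → ∃₂ λ e Q → ∀ k → runsAux y k w ≡ (y , k + e) ∷ Q
runsAux-head y [] = 0 , [] , λ k → cong (λ n → (y , n) ∷ []) (sym (+-identityʳ k))
runsAux-head a (a ∷ w) with e , Q , head ← runsAux-head a w =
  suc e , Q , λ k → trans (head (suc k)) (cong (λ n → (a , n) ∷ Q) (sym (+-suc k e)))
runsAux-head b (b ∷ w) with e , Q , head ← runsAux-head b w =
  suc e , Q , λ k → trans (head (suc k)) (cong (λ n → (b , n) ∷ Q) (sym (+-suc k e)))
runsAux-head a (b ∷ w) = 0 , runsAux b 0 w , λ k → cong (λ n → (a , n) ∷ runsAux b 0 w) (sym (+-identityʳ k))
runsAux-head b (a ∷ w) = 0 , runsAux a 0 w , λ k → cong (λ n → (b , n) ∷ runsAux a 0 w) (sym (+-identityʳ k))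

_≟ᴸ_ : DecidableEquality Letter
a ≟ᴸ a = yes refl
a ≟ᴸ b = no λ ()
b ≟ᴸ a = no λ ()
b ≟ᴸ b = yes refl

eqL-refl : ∀ x → eqL x x ≡ true
eqL-refl a = refl
eqL-refl b = refl

eqL≡false⇔≢ : ∀ {x y} → eqL x y ≡ false ⇔ x ≢ y
eqL≡false⇔≢ {a} {a} = mk⇔ (λ ()) (λ a≢a → contradiction refl a≢a)
eqL≡false⇔≢ {a} {b} = mk⇔ (λ _ ()) (λ _ → refl)
eqL≡false⇔≢ {b} {a} = mk⇔ (λ _ ()) (λ _ → refl)
eqL≡false⇔≢ {b} {b} = mk⇔ (λ ()) (λ b≢b → contradiction refl b≢b)

additive : Letter → Word → Letter → Word → Bool
additive x us y vs =
  not (eqL (lastLetter x us) y) ∧ even (length (u₂ (x ∷ us))) ∧ even (length (v₁ (y ∷ vs)))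

T-additive⇔ : ∀ x us y vs →
  T (additive x us y vs) ⇔
  ((lastLetter x us ≢ y) × 2 ∣ length (u₂ (x ∷ us)) × 2 ∣ length (v₁ (y ∷ vs)))
T-additive⇔ x us y vs =
  ((eqL≡false⇔≢ ⇔-∘ T-not-≡) ×-⇔ (T-even⇔2∣ _ ×-⇔ T-even⇔2∣ _)) ⇔-∘ ((⇔-refl ×-⇔ T-∧) ⇔-∘ T-∧)

δ-++ : ∀ x us y vs → δ (x ∷ us) + δ (y ∷ vs) ≡ δ ((x ∷ us) ++ y ∷ vs) + bit (not (additive x us y vs))
δ-++ x us y vs with P , j , runs-u , runs-u++ ← runsAux-++ x 0 us | lastLetter x us ≟ᴸ y
... | no z≢y with P′ , l , runs-v , _ ← runsAux-++ y 0 vs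
  rewrite runs-u | runs-u++ (y ∷ vs) | Equivalence.from eqL≡false⇔≢ z≢y | runs-v
  = δRuns-join P (lastLetter x us) j P′ (lastLetter y vs) l
... | yes refl with e , Q , runs-v ← runsAux-head (lastLetter x us) vs
  rewrite runs-u | runs-u++ (lastLetter x us ∷ vs) | eqL-refl (lastLetter x us) | runs-v (suc j) | runs-v 0
  = δRuns-merge P (lastLetter x us) j e (j + e) Q

defect-conclusion : ∀ {A B C : ℕ} {Q : Set} b → A + B ≡ C + bit (not b) → T b ⇔ Q →
  (A + B ∸ 1 ≤ C) × (C ≤ A + B) × ((C ≡ A + B) ⇔ Q)
defect-conclusion {C = C} true A+B≡C+0 Tb⇔Q rewrite A+B≡C+0 | +-identityʳ C =
  m∸n≤m C 1 , ≤-refl , mk⇔ (λ _ → Equivalence.to Tb⇔Q _) (λ _ → refl)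
defect-conclusion {C = C} false A+B≡C+1 Tb⇔Q rewrite A+B≡C+1 | +-comm C 1 =
  ≤-refl , n≤1+n C , mk⇔ (λ C≡1+C → contradiction (sym C≡1+C) (1+n≢n)) (λ q → ⊥-elim (Equivalence.from Tb⇔Q q))

mainTheorem12 : (x : Letter) (us : Word) (y : Letter) (vs : Word) →
    let u = x ∷ us
        v = y ∷ vs
    in (δ u + δ v ∸ 1 ≤ δ (u ++ v)) × (δ (u ++ v) ≤ δ u + δ v) ×
       ((δ (u ++ v) ≡ δ u + δ v) ⇔
         ((lastLetter x us ≢ y) × 2 ∣ length (u₂ u) × 2 ∣ length (v₁ v)))
mainTheorem12 x us y vs =
  defect-conclusion {A = δ (x ∷ us)} {B = δ (y ∷ vs)} (additive x us y vs) (δ-++ x us y vs) (T-additive⇔ x us y vs)
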